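{- Let $n\ge2$ and let $S=\{s_1<\cdots<s_{k_1}\}$, $T=\{t_1<\cdots<t_{k_2}\}$ be nonempty subsets of $\{1,\ldots,n-1\}$ with $\max S+\min T\le n$ and $\min S+\max T\le n$. Let $A=T_n\langle S;T\rangle$, $d=\gcd\{s+t\mid s\in S,\ t\in T\}$ and $d'=\gcd(d,s_1)$. Suppose that for each $1\le i\le d$, the principal submatrix of $AA^T$ with rows and columns indexed by $\{v\in[n]\mid v\equiv i\pmod d\}$ is irreducible. Then the competition index of $A$ is at most \[2\left(\lceil n/d\rceil-1\right)\left(\max\left\{\left\lceil\frac{t_{k_2}}{s_1}\right\rceil,\left\lceil\frac{s_{k_1}}{t_1}\right\rceil\right\}+1\right)+2(s_1+t_1).\]
   Context: Boolean arithmetic on $\{0,1\}$: $1+1=1$, otherwise usual; products are Boolean. $T_n\langle S;T\rangle$ is the $n\times n$ Boolean matrix whose $(i,j)$-entry is $1$ iff $j-i\in S$ or $i-j\in T$. A square Boolean matrix is irreducible if the digraph having it as adjacency matrix is strongly connected (equivalently, it is not permutation-similar to a block upper triangular matrix with at least two square diagonal blocks). The competition index of $A$ is the smallest positive integer $q$ such that for some positive integer $r$, $A^{q+i}(A^T)^{q+i}=A^{q+r+i}(A^T)^{q+r+i}$ for every integer $i\ge0$. -}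

module Defs where

open import Data.Bool using (Bool; true; false; _∧_; _∨_)
open import Data.Nat using (ℕ; zero; suc; _+_; _*_; _∸_; _≤_; _<_; _<ᵇ_; ∣_-_∣; _/_)
open import Data.Nat.Divisibility using (_∣_)
open import Data.Nat.GCD using (gcd)
open import Data.Fin using (Fin; toℕ; _≟_)
open import Data.Bool.ListAction using (any)
open import Data.List using (List; allFin; upTo; concatMap; foldr; map; filterᵇ)
open import Data.Product using (_×_; Σ)
open import Relation.Nullary using (does)
open import Relation.Binary.PropositionalEquality using (_≡_)

-- n × n Boolean matrices.  Index v : Fin n stands for the element
-- toℕ v + 1 of [n] = {1,…,n}.
Mat : ℕ → Set
Mat n = Fin n → Fin n → Bool

_≋_ : ∀ {n} → Mat n → Mat n → Set
A ≋ B = ∀ i j → A i j ≡ B i j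

_⊗_ : ∀ {n} → Mat n → Mat n → Mat n
_⊗_ {n} A B i j = any (λ k → A i k ∧ B k j) (allFin n)

I : ∀ {n} → Mat n
I i j = does (i ≟ j)

_^_ : ∀ {n} → Mat n → ℕ → Mat n
A ^ zero  = I
A ^ suc m = A ⊗ (A ^ m)

_ᵀ : ∀ {n} → Mat n → Mat n
(A ᵀ) i j = A j i

-- Entry (i,j) is 1 iff j - i ∈ S or i - j ∈ T.
-- (Since S, T consist of positive integers, j - i ∈ S forces j > i.)
Toeplitz : (n : ℕ) → (ℕ → Bool) → (ℕ → Bool) → Mat n
Toeplitz n S T i j =
  ((toℕ i <ᵇ toℕ j) ∧ S (toℕ j ∸ toℕ i)) ∨ ((toℕ j <ᵇ toℕ i) ∧ T (toℕ i ∸ toℕ j))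

data Walk {n : ℕ} (M : Mat n) (P : Fin n → Set) : Fin n → Fin n → Set where
  here : ∀ {u} → Walk M P u u
  step : ∀ {u w v} → M u w ≡ true → P w → Walk M P w v → Walk M P u v

-- The principal submatrix of M with rows/columns indexed by P is
-- irreducible: the digraph of that submatrix (= the subdigraph of the
-- digraph of M induced on P) is strongly connected.
IrreducibleOn : ∀ {n} → Mat n → (Fin n → Set) → Set
IrreducibleOn {n} M P = ∀ (u v : Fin n) → P u → P v → Walk M P u v

CompetitionProperty : ∀ {n} → Mat n → ℕ → Set
CompetitionProperty A q =
  Σ ℕ λ r → (1 ≤ r) ×
    (∀ i → ((A ^ (q + i)) ⊗ ((A ᵀ) ^ (q + i)))
         ≋ ((A ^ (q + r + i)) ⊗ ((A ᵀ) ^ (q + r + i))))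

IsCompetitionIndex : ∀ {n} → Mat n → ℕ → Set
IsCompetitionIndex A q =
  (1 ≤ q) × CompetitionProperty A q ×
  (∀ q' → 1 ≤ q' → CompetitionProperty A q' → q ≤ q')

IsMin : (ℕ → Bool) → ℕ → Set
IsMin S m = (S m ≡ true) × (∀ x → S x ≡ true → m ≤ x)

IsMax : (ℕ → Bool) → ℕ → Set
IsMax S m = (S m ≡ true) × (∀ x → S x ≡ true → x ≤ m)

-- d = gcd { s + t | s ∈ S, t ∈ T }, where S, T ⊆ {0,…,n-1}
-- (the gcd of the list of all such sums, gcd of the empty list being 0)
sumGcd : ℕ → (ℕ → Bool) → (ℕ → Bool) → ℕ
sumGcd n S T =
  foldr gcd 0
    (concatMap (λ s → map (λ t → s + t) (filterᵇ T (upTo n))) (filterᵇ S (upTo n)))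

-- ⌈a / b⌉ for b ≥ 1 (value at b = 0 is irrelevant, set to 0)
⌈_/_⌉ : ℕ → ℕ → ℕ
⌈ a / zero ⌉  = 0
⌈ a / suc b ⌉ = (a + b) / suc b

_≡_[mod_] : ℕ → ℕ → ℕ → Set
a ≡ b [mod d ] = d ∣ ∣ a - b ∣

-- Every arc of A moves a vertex by +s with s ∈ S or by −t with t ∈ T, and d divides
-- every s + t, so a walk of length k from x ends at a vertex y with y + k t₁ ≡ x (mod d).
-- Hence the (u, v) entry of A^k (Aᵀ)^k, which says that u and v have a common k-step
-- out-neighbour, can only be 1 when u ≡ v (mod d).
--
-- Conversely let u ≡ v (mod d), and take a walk from u to v inside the residue class of u
-- in the digraph of A Aᵀ without repeated vertices: it has at most ⌈n/d⌉ − 1 steps.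
-- Put Q = s₁ + t₁ and call e + ℓ t₁ (mod Q) the phase of a walk of length ℓ ending at e.
-- Steps by +s₁ and −t₁ do not change the phase; using them, every arc x → z can be
-- imitated from any vertex in at most c + 1 steps, c = max(⌈tₖ/s₁⌉, ⌈sₖ/t₁⌉), shifting the
-- phase by z − x + t₁.  Imitating the two arcs x → z ← x′ of each step of the short walk,
-- walks from u and from v reach equal phases within (⌈n/d⌉ − 1)(c + 1) steps.  Padding
-- both with +s₁ and −t₁ steps to a common length k ≥ K, the stated bound, leads them to
-- the same vertex, the one below Q determined by the phase.  So A^k (Aᵀ)^k does not
-- change from k = K on, and the competition index is at most K.

module Submission where

open import Defs
open import Data.Bool using (Bool; true; _∧_; T?)
open import Data.Bool.Properties using (T-≡; T-∧; T-∨; ⇔→≡)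
open import Data.Nat using (ℕ; zero; suc; _+_; _*_; _∸_; _≤_; _<_; _⊔_; _%_; _/_; pred;
  NonZero; >-nonZero; >-nonZero⁻¹; ≢-nonZero; ≢-nonZero⁻¹; z≤n; s≤s; s≤s⁻¹; _<?_; _≤?_)
open import Data.Nat.Properties hiding (_≟_)
open import Algebra.Properties.CommutativeSemigroup +-commutativeSemigroup
  using () renaming (xy∙z≈xz∙y to +-right-comm)
open import Data.Nat.DivMod
  using (m≡m%n+[m/n]*n; %-distribˡ-+; [m+kn]%n≡m%n; m%n%n≡m%n; %-remove-+ʳ; m<n⇒m%n≡m; m%n<n; m/n*n≤m)
open import Data.Nat.Divisibility using (_∣_; ∣-trans; ∣⇒≤; 0∣⇒≡0; m%n≡0⇒n∣m)
open import Data.Nat.GCD using (gcd; gcd[m,n]∣m; gcd[m,n]∣n)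
open import Data.Nat.Tactic.RingSolver using (solve-∀)
open import Data.Fin using (Fin; toℕ; fromℕ<; _≟_)
open import Data.Fin.Properties using (toℕ-injective; toℕ-fromℕ<; toℕ<n; injective⇒≤)
open import Data.List using (List; []; _∷_; length; lookup; allFin; foldr; map; filterᵇ; upTo)
open import Data.List.Membership.Propositional using (_∈_; lose)
open import Data.List.Membership.Propositional.Properties
  using (∈-allFin; ∈-lookup; ∈-filter⁺; ∈-map⁺; ∈-concatMap⁺; ∈-upTo⁺)
open import Data.List.Relation.Unary.All as All using (All; []; _∷_)
open import Data.List.Relation.Unary.All.Properties.Core using (¬Any⇒All¬)
open import Data.List.Relation.Unary.Any as Any using (here; there; satisfied)
open import Data.List.Relation.Unary.Any.Properties using (any⁺; any⁻)
open import Data.List.Relation.Unary.Unique.Propositional using (Unique)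
open import Data.List.Relation.Unary.AllPairs.Core using ([]; _∷_)
open import Data.Product using (Σ; _×_; _,_; proj₁; proj₂; ∃-syntax; ∃₂)
open import Data.Sum using (_⊎_; inj₁; inj₂)
open import Function using (id; _∘_; _⇔_; mk⇔; Equivalence)
open import Relation.Nullary using (yes; no; contradiction)
open import Relation.Nullary.Decidable using (dec-true)
open import Level using (0ℓ)
open import Relation.Binary.Bundles using (Setoid)
open import Relation.Binary.PropositionalEquality
import Relation.Binary.Reasoning.Setoid as SetoidReasoning

open Equivalence using (to; from)

-- Walks of prescribed length and Boolean matrix powers

infixr 5 _◅_

data Path {n : ℕ} (M : Mat n) : ℕ → Fin n → Fin n → Set where
  ε   : ∀ {i} → Path M 0 i i
  _◅_ : ∀ {k i j l} → M i j ≡ true → Path M k j l → Path M (suc k) i l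

infixr 5 _◅◅_

_◅◅_ : ∀ {n} {M : Mat n} {a b i j l} → Path M a i j → Path M b j l → Path M (a + b) i l
ε ◅◅ q = q
(e ◅ p) ◅◅ q = e ◅ (p ◅◅ q)

_▻_ : ∀ {n} {M : Mat n} {k i j l} → Path M k i j → M j l ≡ true → Path M (suc k) i l
ε ▻ e = e ◅ ε
(e′ ◅ p) ▻ e = e′ ◅ (p ▻ e)

reverse : ∀ {n} {M : Mat n} {k i j} → Path M k i j → Path (M ᵀ) k j i
reverse ε = ε
reverse (e ◅ p) = reverse p ▻ e

module _ {n : ℕ} (A B : Mat n) where

  ⊗-true⁻ : ∀ {i j} → (A ⊗ B) i j ≡ true → ∃[ k ] A i k ≡ true × B k j ≡ true
  ⊗-true⁻ {i} {j} ABij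
    with k , Aik∧Bkj ← satisfied (any⁻ (λ k → A i k ∧ B k j) (allFin n) (from T-≡ ABij))
    with Aik , Bkj ← to T-∧ Aik∧Bkj
    = k , to T-≡ Aik , to T-≡ Bkj

  ⊗-true⁺ : ∀ {i k j} → A i k ≡ true → B k j ≡ true → (A ⊗ B) i j ≡ true
  ⊗-true⁺ {i} {k} {j} Aik Bkj = to T-≡ (any⁺ (λ k → A i k ∧ B k j)
    (lose (∈-allFin k) (from T-∧ (from T-≡ Aik , from T-≡ Bkj))))

module _ {n : ℕ} (M : Mat n) where

  ^-true⇒Path : ∀ k {i j} → (M ^ k) i j ≡ true → Path M k i j
  ^-true⇒Path zero {i} {j} Iij with i ≟ j
  ... | yes refl = ε
  ^-true⇒Path (suc k) Mᵏ⁺¹ij with l , Mil , Mᵏlj ← ⊗-true⁻ M (M ^ k) Mᵏ⁺¹ij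
    = Mil ◅ ^-true⇒Path k Mᵏlj

  Path⇒^-true : ∀ {k i j} → Path M k i j → (M ^ k) i j ≡ true
  Path⇒^-true {i = i} ε = dec-true (i ≟ i) refl
  Path⇒^-true {suc k} (Mij ◅ p) = ⊗-true⁺ M (M ^ k) Mij (Path⇒^-true p)

CommonTarget : ∀ {n} → Mat n → ℕ → Fin n → Fin n → Set
CommonTarget A k u v = ∃[ w ] Path A k u w × Path A k v w

competition⇔CommonTarget : ∀ {n} (A : Mat n) k {u v} →
  ((A ^ k) ⊗ ((A ᵀ) ^ k)) u v ≡ true ⇔ CommonTarget A k u v
competition⇔CommonTarget A k = mk⇔
  (λ entry → let w , Aᵏuw , Aᵀᵏwv = ⊗-true⁻ (A ^ k) ((A ᵀ) ^ k) entry
             in w , ^-true⇒Path A k Aᵏuw , reverse (^-true⇒Path (A ᵀ) k Aᵀᵏwv))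
  (λ (w , p , q) → ⊗-true⁺ (A ^ k) ((A ᵀ) ^ k) (Path⇒^-true A p) (Path⇒^-true (A ᵀ) (reverse q)))

-- Loop erasure of walks inside a vertex set

module _ {n : ℕ} {M : Mat n} {P : Fin n → Set} where

  open import Data.List.Membership.DecPropositional (_≟_ {n}) using (_∈?_)

  walkLength : ∀ {u v} → Walk M P u v → ℕ
  walkLength here = 0
  walkLength (step _ _ w) = suc (walkLength w)

  vertices : ∀ {u v} → Walk M P u v → List (Fin n)
  vertices {u} here = u ∷ []
  vertices {u} (step _ _ w) = u ∷ vertices w

  length-vertices : ∀ {u v} (w : Walk M P u v) → length (vertices w) ≡ suc (walkLength w)
  length-vertices here = refl
  length-vertices (step _ _ w) = cong suc (length-vertices w)

  All-vertices : ∀ {u v} → P u → (w : Walk M P u v) → All P (vertices w)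
  All-vertices Pu here = Pu ∷ []
  All-vertices Pu (step _ Pw w) = Pu ∷ All-vertices Pw w

  suffixFrom : ∀ {u v x} (w : Walk M P u v) → x ∈ vertices w →
    Σ (Walk M P x v) λ w′ → Unique (vertices w) → Unique (vertices w′)
  suffixFrom here (here refl) = here , id
  suffixFrom (step e Pw w) (here refl) = step e Pw w , id
  suffixFrom (step e Pw w) (there x∈w) with w′ , uniq ← suffixFrom w x∈w
    = w′ , λ { (_ ∷ u) → uniq u }

  loopErase : ∀ {u v} → Walk M P u v → Σ (Walk M P u v) (Unique ∘ vertices)
  loopErase here = here , [] ∷ []
  loopErase (step {u} e Pw w) with w′ , uniq ← loopErase w with u ∈? vertices w′
  ... | yes u∈w′ = proj₁ (suffixFrom w′ u∈w′) , proj₂ (suffixFrom w′ u∈w′) uniq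
  ... | no u∉w′ = step e Pw w′ , ¬Any⇒All¬ _ u∉w′ ∷ uniq

Unique⇒lookup-injective : ∀ {A : Set} {xs : List A} → Unique xs →
  ∀ i j → lookup xs i ≡ lookup xs j → i ≡ j
Unique⇒lookup-injective (_ ∷ _) Fin.zero Fin.zero _ = refl
Unique⇒lookup-injective (x∉ ∷ _) Fin.zero (Fin.suc j) eq =
  contradiction eq (All.lookup x∉ (∈-lookup j))
Unique⇒lookup-injective (x∉ ∷ _) (Fin.suc i) Fin.zero eq =
  contradiction (sym eq) (All.lookup x∉ (∈-lookup i))
Unique⇒lookup-injective (_ ∷ u) (Fin.suc i) (Fin.suc j) eq = cong Fin.suc (Unique⇒lookup-injective u i j eq)

Unique-length≤ : ∀ {A : Set} {P : A → Set} (g : A → ℕ) {N} →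
  (∀ {x} → P x → g x < N) → (∀ {x y} → P x → P y → g x ≡ g y → x ≡ y) →
  ∀ {xs} → Unique xs → All P xs → length xs ≤ N
Unique-length≤ {P = P} g {N} g<N g-inj {xs} uniq Pxs = injective⇒≤ {f = index} index-injective
  where
  P-at : ∀ i → P (lookup xs i)
  P-at i = All.lookup Pxs (∈-lookup i)
  index : Fin (length xs) → Fin N
  index i = fromℕ< (g<N (P-at i))
  index-injective : ∀ {i j} → index i ≡ index j → i ≡ j
  index-injective {i} {j} eq = Unique⇒lookup-injective uniq i j (g-inj (P-at i) (P-at j) (begin
    g (lookup xs i)        ≡⟨ toℕ-fromℕ< (g<N (P-at i)) ⟨
    toℕ (index i)          ≡⟨ cong toℕ eq ⟩
    toℕ (index j)          ≡⟨ toℕ-fromℕ< (g<N (P-at j)) ⟩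
    g (lookup xs j)        ∎))
    where open ≡-Reasoning

shortWalk : ∀ {n} {M : Mat n} {P : Fin n → Set} (g : Fin n → ℕ) {N} →
  (∀ {x} → P x → g x < N) → (∀ {x y} → P x → P y → g x ≡ g y → x ≡ y) →
  ∀ {u v} → P u → Walk M P u v → Σ (Walk M P u v) λ w → walkLength w < N
shortWalk g g<N g-inj Pu w with w′ , uniq ← loopErase w
  = w′ , subst (_≤ _) (length-vertices w′) (Unique-length≤ g g<N g-inj uniq (All-vertices Pu w′))

-- Congruence modulo a positive integer

-- Defined through remainders, so that it is an equivalence by construction;
-- [mod]⇔≡ below relates it to the divisibility form _≡_[mod_] used in the statement.
infix 4 _≡_⟨mod_⟩

_≡_⟨mod_⟩ : ℕ → ℕ → (m : ℕ) → .{{NonZero m}} → Set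
a ≡ b ⟨mod m ⟩ = a % m ≡ b % m

module ModularArithmetic (m : ℕ) .{{_ : NonZero m}} where

  ≡-mod-setoid : Setoid 0ℓ 0ℓ
  ≡-mod-setoid = record
    { Carrier = ℕ
    ; _≈_ = _≡_⟨mod m ⟩
    ; isEquivalence = record { refl = refl ; sym = sym ; trans = trans }
    }

  module ≡-mod-Reasoning = SetoidReasoning ≡-mod-setoid

  +-cong : ∀ {a b c e} → a ≡ b ⟨mod m ⟩ → c ≡ e ⟨mod m ⟩ → a + c ≡ b + e ⟨mod m ⟩
  +-cong {a} {b} {c} {e} a≡b c≡e = begin
    (a + c) % m           ≡⟨ %-distribˡ-+ a c m ⟩
    (a % m + c % m) % m   ≡⟨ cong₂ (λ x y → (x + y) % m) a≡b c≡e ⟩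
    (b % m + e % m) % m   ≡⟨ %-distribˡ-+ b e m ⟨
    (b + e) % m           ∎
    where open ≡-Reasoning

  +-congˡ : ∀ {a b} c → a ≡ b ⟨mod m ⟩ → c + a ≡ c + b ⟨mod m ⟩
  +-congˡ c = +-cong {c} refl

  +-congʳ : ∀ {a b} c → a ≡ b ⟨mod m ⟩ → a + c ≡ b + c ⟨mod m ⟩
  +-congʳ c a≡b = +-cong a≡b (refl {x = c % m})

  a+k*m≡a : ∀ a k → a + k * m ≡ a ⟨mod m ⟩
  a+k*m≡a a k = [m+kn]%n≡m%n a k m

  a%m≡a : ∀ a → a % m ≡ a ⟨mod m ⟩
  a%m≡a a = m%n%n≡m%n a m

  +-cancelʳ : ∀ {a b} x → a + x ≡ b + x ⟨mod m ⟩ → a ≡ b ⟨mod m ⟩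
  +-cancelʳ {a} {b} x a+x≡b+x = begin
    a                       ≈⟨ a+k*m≡a a x ⟨
    a + x * m               ≡⟨ split a ⟩
    a + x + x * pred m      ≈⟨ +-congʳ (x * pred m) a+x≡b+x ⟩
    b + x + x * pred m      ≡⟨ split b ⟨
    b + x * m               ≈⟨ a+k*m≡a b x ⟩
    b                       ∎
    where
    open ≡-mod-Reasoning
    split : ∀ c → c + x * m ≡ c + x + x * pred m
    split c = trans (cong (λ k → c + x * k) (sym (suc-pred m))) (+-*-suc-split c x (pred m))
      where
      +-*-suc-split : ∀ c x p → c + x * suc p ≡ c + x + x * p
      +-*-suc-split = solve-∀

  +-cancelˡ : ∀ x {a b} → x + a ≡ x + b ⟨mod m ⟩ → a ≡ b ⟨mod m ⟩
  +-cancelˡ x {a} {b} x+a≡x+b = +-cancelʳ x (begin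
    (a + x) % m ≡⟨ cong (_% m) (+-comm a x) ⟩
    (x + a) % m ≡⟨ x+a≡x+b ⟩
    (x + b) % m ≡⟨ cong (_% m) (+-comm x b) ⟩
    (b + x) % m ∎)
    where open ≡-Reasoning

  ∣a+b⇒∣a+c⇒b≡c : ∀ {a b c} → m ∣ a + b → m ∣ a + c → b ≡ c ⟨mod m ⟩
  ∣a+b⇒∣a+c⇒b≡c {a} {b} {c} m∣a+b m∣a+c = begin
    b                 ≈⟨ %-remove-+ʳ b m∣a+c ⟨
    b + (a + c)       ≡⟨ swap b a c ⟩
    c + (a + b)       ≈⟨ %-remove-+ʳ c m∣a+b ⟩
    c                 ∎
    where
    open ≡-mod-Reasoning
    swap : ∀ b a c → b + (a + c) ≡ c + (a + b)
    swap = solve-∀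

  a≤b⇒[m∣b∸a⇔a≡b] : ∀ {a b} → a ≤ b → m ∣ b ∸ a ⇔ a ≡ b ⟨mod m ⟩
  a≤b⇒[m∣b∸a⇔a≡b] {a} {b} a≤b = mk⇔
    (λ m∣b∸a → trans (sym (%-remove-+ʳ a m∣b∸a)) a+[b∸a]≡b)
    (λ a≡b → m%n≡0⇒n∣m (b ∸ a) m
      (trans (+-cancelˡ a (trans a+[b∸a]≡b (trans (sym a≡b) (cong (_% m) (sym (+-identityʳ a))))))
             (m<n⇒m%n≡m (>-nonZero⁻¹ m))))
    where
    a+[b∸a]≡b : a + (b ∸ a) ≡ b ⟨mod m ⟩
    a+[b∸a]≡b = cong (_% m) (m+[n∸m]≡n a≤b)

  [mod]⇔≡ : ∀ a b → a ≡ b [mod m ] ⇔ a ≡ b ⟨mod m ⟩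
  [mod]⇔≡ a b with ≤-total a b
  ... | inj₁ a≤b rewrite m≤n⇒∣m-n∣≡n∸m a≤b = a≤b⇒[m∣b∸a⇔a≡b] a≤b
  ... | inj₂ b≤a rewrite m≤n⇒∣n-m∣≡n∸m b≤a =
    let b≡a = a≤b⇒[m∣b∸a⇔a≡b] b≤a in mk⇔ (sym ∘ to b≡a) (from b≡a ∘ sym)

-- Ceilings and gcds

≤⌈/⌉* : ∀ a b → 1 ≤ b → a ≤ ⌈ a / b ⌉ * b
≤⌈/⌉* a (suc b) _ = +-cancelʳ-≤ b a _ (begin
  a + b                                       ≡⟨ m≡m%n+[m/n]*n (a + b) (suc b) ⟩
  (a + b) % suc b + (a + b) / suc b * suc b   ≤⟨ +-monoˡ-≤ _ (s≤s⁻¹ (m%n<n (a + b) (suc b))) ⟩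
  b + (a + b) / suc b * suc b                 ≡⟨ +-comm b _ ⟩
  (a + b) / suc b * suc b + b                 ∎)
  where open ≤-Reasoning

/<⌈/⌉ : ∀ {x a} b .{{_ : NonZero b}} → x < a → x / b < ⌈ a / b ⌉
/<⌈/⌉ {x} {a} (suc b) x<a = *-cancelʳ-< (suc b) _ _ (begin-strict
  x / suc b * suc b         ≤⟨ m/n*n≤m x (suc b) ⟩
  x                         <⟨ x<a ⟩
  a                         ≤⟨ ≤⌈/⌉* a (suc b) (s≤s z≤n) ⟩
  ⌈ a / suc b ⌉ * suc b     ∎)
  where open ≤-Reasoning

foldr-gcd-∣ : ∀ {x} (xs : List ℕ) → x ∈ xs → foldr gcd 0 xs ∣ x
foldr-gcd-∣ (y ∷ ys) (here refl) = gcd[m,n]∣m y (foldr gcd 0 ys)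
foldr-gcd-∣ (y ∷ ys) (there x∈ys) = ∣-trans (gcd[m,n]∣n y (foldr gcd 0 ys)) (foldr-gcd-∣ ys x∈ys)

sumGcd-∣ : ∀ {n S T s t} → S s ≡ true → s < n → T t ≡ true → t < n → sumGcd n S T ∣ s + t
sumGcd-∣ {n} {S} {T} {s} {t} Ss s<n Tt t<n =
  foldr-gcd-∣ _ (∈-concatMap⁺ (λ s → map (s +_) (filterᵇ T (upTo n)))
    (Any.map (λ { refl → ∈-map⁺ (s +_) (∈-filterᵇ T t<n Tt) }) (∈-filterᵇ S s<n Ss)))
  where
  ∈-filterᵇ : ∀ B {x} → x < n → B x ≡ true → x ∈ filterᵇ B (upTo n)
  ∈-filterᵇ B x<n Bx = ∈-filter⁺ (T? ∘ B) (∈-upTo⁺ x<n) (from T-≡ Bx)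

-- Arcs of the Toeplitz digraph

module ToeplitzArcs {n : ℕ} (S T : ℕ → Bool) where

  arc⁻ : ∀ {x y} → Toeplitz n S T x y ≡ true →
    (∃[ s ] S s ≡ true × toℕ y ≡ toℕ x + s) ⊎ (∃[ t ] T t ≡ true × toℕ x ≡ toℕ y + t)
  arc⁻ {x} {y} Axy with to T-∨ (from T-≡ Axy)
  ... | inj₁ forward with x<y , Sy∸x ← to T-∧ forward
    = inj₁ (toℕ y ∸ toℕ x , to T-≡ Sy∸x , sym (m+[n∸m]≡n (<⇒≤ (<ᵇ⇒< _ _ x<y))))
  ... | inj₂ backward with y<x , Tx∸y ← to T-∧ backward
    = inj₂ (toℕ x ∸ toℕ y , to T-≡ Tx∸y , sym (m+[n∸m]≡n (<⇒≤ (<ᵇ⇒< _ _ y<x))))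

  arc-forward : ∀ {s x y} → S s ≡ true → 1 ≤ s → toℕ y ≡ toℕ x + s → Toeplitz n S T x y ≡ true
  arc-forward {s} {x} {y} Ss 1≤s y≡x+s = to T-≡ (from T-∨ (inj₁ (from T-∧ (<⇒<ᵇ x<y , from T-≡ Sy∸x))))
    where
    x<y : toℕ x < toℕ y
    x<y = subst (toℕ x <_) (sym y≡x+s) (m<m+n (toℕ x) 1≤s)
    Sy∸x : S (toℕ y ∸ toℕ x) ≡ true
    Sy∸x = subst (λ z → S z ≡ true) (sym (trans (cong (_∸ toℕ x) y≡x+s) (m+n∸m≡n (toℕ x) s))) Ss

  arc-backward : ∀ {t x y} → T t ≡ true → 1 ≤ t → toℕ x ≡ toℕ y + t → Toeplitz n S T x y ≡ true
  arc-backward {t} {x} {y} Tt 1≤t x≡y+t = to T-≡ (from T-∨ (inj₂ (from T-∧ (<⇒<ᵇ y<x , from T-≡ Tx∸y))))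
    where
    y<x : toℕ y < toℕ x
    y<x = subst (toℕ y <_) (sym x≡y+t) (m<m+n (toℕ y) 1≤t)
    Tx∸y : T (toℕ x ∸ toℕ y) ≡ true
    Tx∸y = subst (λ z → T z ≡ true) (sym (trans (cong (_∸ toℕ y) x≡y+t) (m+n∸m≡n (toℕ y) t))) Tt

  step-forward : ∀ {s} → S s ≡ true → 1 ≤ s → (x : Fin n) → toℕ x + s < n →
    ∃[ y ] toℕ y ≡ toℕ x + s × Toeplitz n S T x y ≡ true
  step-forward Ss 1≤s x fits = fromℕ< fits , toℕ-fromℕ< fits , arc-forward Ss 1≤s (toℕ-fromℕ< fits)

  step-backward : ∀ {t} → T t ≡ true → 1 ≤ t → (x : Fin n) → t ≤ toℕ x →
    ∃[ y ] toℕ y + t ≡ toℕ x × Toeplitz n S T x y ≡ true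
  step-backward {t} Tt 1≤t x t≤x = y , y+t≡x , arc-backward Tt 1≤t (sym y+t≡x)
    where
    fits : toℕ x ∸ t < n
    fits = ≤-<-trans (m∸n≤m (toℕ x) t) (toℕ<n x)
    y : Fin n
    y = fromℕ< fits
    y+t≡x : toℕ y + t ≡ toℕ x
    y+t≡x = trans (cong (_+ t) (toℕ-fromℕ< fits)) (m∸n+n≡m t≤x)

-- Residues modulo d along walks

module ToeplitzResidues {n : ℕ} {S T : ℕ → Bool} (d : ℕ) .{{_ : NonZero d}}
  (d∣s+t : ∀ {s t} → S s ≡ true → T t ≡ true → d ∣ s + t)
  {s₀ t₀ : ℕ} (s₀∈S : S s₀ ≡ true) (t₀∈T : T t₀ ≡ true) where

  open ModularArithmetic d
  open ≡-mod-Reasoning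
  open ToeplitzArcs {n} S T using (arc⁻)

  arc⇒≡ : ∀ {x y} → Toeplitz n S T x y ≡ true → toℕ y + t₀ ≡ toℕ x ⟨mod d ⟩
  arc⇒≡ {x} {y} Axy with arc⁻ Axy
  ... | inj₁ (s , Ss , y≡x+s) = begin
    toℕ y + t₀          ≡⟨ cong (_+ t₀) y≡x+s ⟩
    toℕ x + s + t₀      ≡⟨ +-assoc (toℕ x) s t₀ ⟩
    toℕ x + (s + t₀)    ≈⟨ %-remove-+ʳ (toℕ x) (d∣s+t Ss t₀∈T) ⟩
    toℕ x               ∎
  ... | inj₂ (t , Tt , x≡y+t) = begin
    toℕ y + t₀          ≈⟨ +-congˡ (toℕ y) (∣a+b⇒∣a+c⇒b≡c (d∣s+t s₀∈S t₀∈T) (d∣s+t s₀∈S Tt)) ⟩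
    toℕ y + t           ≡⟨ x≡y+t ⟨
    toℕ x               ∎

  Path⇒≡ : ∀ {k x y} → Path (Toeplitz n S T) k x y → toℕ y + k * t₀ ≡ toℕ x ⟨mod d ⟩
  Path⇒≡ {x = x} ε = cong (_% d) (+-identityʳ (toℕ x))
  Path⇒≡ {suc k} {x} {y} (_◅_ {j = z} Axz p) = begin
    toℕ y + (t₀ + k * t₀)   ≡⟨ cong (toℕ y +_) (+-comm t₀ (k * t₀)) ⟩
    toℕ y + (k * t₀ + t₀)   ≡⟨ +-assoc (toℕ y) (k * t₀) t₀ ⟨
    toℕ y + k * t₀ + t₀     ≈⟨ +-congʳ t₀ (Path⇒≡ p) ⟩
    toℕ z + t₀              ≈⟨ arc⇒≡ Axz ⟩
    toℕ x                   ∎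

  CommonTarget⇒≡ : ∀ {k u v} → CommonTarget (Toeplitz n S T) k u v → toℕ u ≡ toℕ v ⟨mod d ⟩
  CommonTarget⇒≡ (_ , p , q) = trans (sym (Path⇒≡ p)) (Path⇒≡ q)

-- Steering walks of the Toeplitz digraph

module ToeplitzWalks {n : ℕ} {S T : ℕ → Bool}
  (S-positive : ∀ {s} → S s ≡ true → 1 ≤ s) (T-positive : ∀ {t} → T t ≡ true → 1 ≤ t)
  {s₀ t₀ : ℕ} (s₀∈S : S s₀ ≡ true) (t₀∈T : T t₀ ≡ true) where

  A : Mat n
  A = Toeplitz n S T

  open ToeplitzArcs {n} S T

  Q : ℕ
  Q = s₀ + t₀

  instance
    Q-nonZero : NonZero Q
    Q-nonZero = >-nonZero (≤-trans (S-positive s₀∈S) (m≤m+n s₀ t₀))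

  open ModularArithmetic Q

  forward-s₀ : (x : Fin n) → toℕ x + s₀ < n → ∃[ y ] toℕ y ≡ toℕ x + s₀ × A x y ≡ true
  forward-s₀ = step-forward s₀∈S (S-positive s₀∈S)

  backward-t₀ : (x : Fin n) → t₀ ≤ toℕ x → ∃[ y ] toℕ y + t₀ ≡ toℕ x × A x y ≡ true
  backward-t₀ = step-backward t₀∈T (T-positive t₀∈T)

  forward-balance : ∀ {a a′} i → a′ ≡ a + s₀ → a + suc i * s₀ ≡ a′ + i * s₀
  forward-balance {a} i a′≡a+s₀ = trans (sym (+-assoc a s₀ (i * s₀))) (cong (_+ i * s₀) (sym a′≡a+s₀))

  backward-balance : ∀ {a a′} b j c → a′ + t₀ ≡ a → b + suc j * t₀ ≡ a + c ⇔ b + j * t₀ ≡ a′ + c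
  backward-balance {a} {a′} b j c a′+t₀≡a = mk⇔
    (λ eq → +-cancelʳ-≡ t₀ _ _ (trans (sym lhs) (trans eq rhs)))
    (λ eq → trans lhs (trans (cong (_+ t₀) eq) (sym rhs)))
    where
    lhs : b + suc j * t₀ ≡ b + j * t₀ + t₀
    lhs = trans (cong (b +_) (+-comm t₀ (j * t₀))) (sym (+-assoc b (j * t₀) t₀))
    rhs : a + c ≡ a′ + c + t₀
    rhs = trans (cong (_+ c) (sym a′+t₀≡a)) (+-right-comm a′ t₀ c)

  zigzag : Q ≤ n → ∀ i j {x y} → toℕ y + j * t₀ ≡ toℕ x + i * s₀ → Path A (i + j) x y
  zigzag _ zero zero {x} {y} y≡x with toℕ-injective {i = x} {j = y} (sym (+-cancelʳ-≡ 0 _ _ y≡x))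
  ... | refl = ε
  zigzag Q≤n zero (suc j) {x} {y} y≡x =
    let x′ , x′+t₀≡x , Axx′ = backward-t₀ x t₀≤x
    in Axx′ ◅ zigzag Q≤n zero j (to (backward-balance (toℕ y) j 0 x′+t₀≡x) y≡x)
    where
    t₀≤x : t₀ ≤ toℕ x
    t₀≤x = ≤-trans (m≤m+n t₀ (j * t₀))
             (≤-trans (m≤n+m _ (toℕ y)) (≤-reflexive (trans y≡x (+-identityʳ (toℕ x)))))
  zigzag Q≤n (suc i) j {x} {y} y≡x with toℕ x + s₀ <? n
  ... | yes fits =
    let x′ , x′≡x+s₀ , Axx′ = forward-s₀ x fits
    in Axx′ ◅ zigzag Q≤n i j (trans y≡x (forward-balance i x′≡x+s₀))
  zigzag Q≤n (suc i) zero {x} {y} y≡x | no ¬fits = contradiction (≤-<-trans x+s₀≤y (toℕ<n y)) ¬fits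
    where
    x+s₀≤y : toℕ x + s₀ ≤ toℕ y
    x+s₀≤y = begin
      toℕ x + s₀                ≤⟨ m≤m+n (toℕ x + s₀) (i * s₀) ⟩
      toℕ x + s₀ + i * s₀       ≡⟨ +-assoc (toℕ x) s₀ (i * s₀) ⟩
      toℕ x + suc i * s₀        ≡⟨ y≡x ⟨
      toℕ y + 0                 ≡⟨ +-identityʳ (toℕ y) ⟩
      toℕ y                     ∎
      where open ≤-Reasoning
  zigzag Q≤n (suc i) (suc j) {x} {y} y≡x | no ¬fits =
    let x′ , x′+t₀≡x , Axx′ = backward-t₀ x t₀≤x
    in subst (λ k → Path A k x y) (sym (+-suc (suc i) j))
         (Axx′ ◅ zigzag Q≤n (suc i) j (to (backward-balance (toℕ y) j (suc i * s₀) x′+t₀≡x) y≡x))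
    where
    t₀≤x : t₀ ≤ toℕ x
    t₀≤x = +-cancelˡ-≤ s₀ t₀ (toℕ x) (≤-trans Q≤n (≤-trans (≮⇒≥ ¬fits) (≤-reflexive (+-comm (toℕ x) s₀))))

  walkToResidue : Q ≤ n → ∀ L (a : Fin n) → n ≤ L * t₀ →
    ∃[ y ] toℕ y ≡ (toℕ a + L * s₀) % Q × Path A L a y
  walkToResidue Q≤n L a n≤Lt₀ =
    y , toℕ-fromℕ< r<n , subst (λ k → Path A k a y) (m∸n+n≡m (<⇒≤ j<L)) (zigzag Q≤n (L ∸ j) j y-balanced)
    where
    N₀ r j : ℕ
    N₀ = toℕ a + L * s₀
    r = N₀ % Q
    j = N₀ / Q
    r<n : r < n
    r<n = <-≤-trans (m%n<n N₀ Q) Q≤n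
    y : Fin n
    y = fromℕ< r<n
    j<L : j < L
    j<L = *-cancelʳ-< Q j L (begin-strict
      j * Q                 ≤⟨ m/n*n≤m N₀ Q ⟩
      toℕ a + L * s₀        <⟨ +-monoˡ-< (L * s₀) (<-≤-trans (toℕ<n a) n≤Lt₀) ⟩
      L * t₀ + L * s₀       ≡⟨ +-comm (L * t₀) (L * s₀) ⟩
      L * s₀ + L * t₀       ≡⟨ *-distribˡ-+ L s₀ t₀ ⟨
      L * Q                 ∎)
      where open ≤-Reasoning
    y-balanced : toℕ y + j * t₀ ≡ toℕ a + (L ∸ j) * s₀
    y-balanced = +-cancelʳ-≡ (j * s₀) _ _ (begin
      toℕ y + j * t₀ + j * s₀       ≡⟨ cong (λ z → z + j * t₀ + j * s₀) (toℕ-fromℕ< r<n) ⟩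
      r + j * t₀ + j * s₀           ≡⟨ regroup r j s₀ t₀ ⟩
      r + j * Q                     ≡⟨ m≡m%n+[m/n]*n N₀ Q ⟨
      toℕ a + L * s₀                ≡⟨ cong (λ k → toℕ a + k * s₀) (m∸n+n≡m (<⇒≤ j<L)) ⟨
      toℕ a + (L ∸ j + j) * s₀      ≡⟨ distribute (toℕ a) (L ∸ j) j s₀ ⟩
      toℕ a + (L ∸ j) * s₀ + j * s₀ ∎)
      where
      open ≡-Reasoning
      regroup : ∀ r j s t → r + j * t + j * s ≡ r + j * (s + t)
      regroup = solve-∀
      distribute : ∀ a i j s → a + (i + j) * s ≡ a + i * s + j * s
      distribute = solve-∀

  advance : ∀ {s} → S s ≡ true → s + t₀ ≤ n → ∀ j (p : Fin n) → toℕ p + s < n + j * t₀ →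
    ∃₂ λ e ℓ → ℓ ≤ j × Path A (suc ℓ) p e × toℕ e + ℓ * t₀ ≡ toℕ p + s
  advance {s} Ss s+t₀≤n j p bound with toℕ p + s <? n
  ... | yes fits =
    let e , e≡p+s , Ape = step-forward Ss (S-positive Ss) p fits
    in e , 0 , z≤n , Ape ◅ ε , trans (+-identityʳ (toℕ e)) e≡p+s
  advance {s} Ss s+t₀≤n zero p bound | no ¬fits =
    contradiction (subst (toℕ p + s <_) (+-identityʳ n) bound) ¬fits
  advance {s} Ss s+t₀≤n (suc j) p bound | no ¬fits =
    let p′ , p′+t₀≡p , App′ = backward-t₀ p t₀≤p
        e , ℓ , ℓ≤j , path , e≡p′+s = advance Ss s+t₀≤n j p′ (bound′ p′+t₀≡p)
    in e , suc ℓ , s≤s ℓ≤j , App′ ◅ path , from (backward-balance (toℕ e) ℓ s p′+t₀≡p) e≡p′+s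
    where
    t₀≤p : t₀ ≤ toℕ p
    t₀≤p = +-cancelˡ-≤ s t₀ (toℕ p) (≤-trans s+t₀≤n (≤-trans (≮⇒≥ ¬fits) (≤-reflexive (+-comm (toℕ p) s))))
    bound′ : ∀ {p′} → toℕ p′ + t₀ ≡ toℕ p → toℕ p′ + s < n + j * t₀
    bound′ {p′} p′+t₀≡p = +-cancelʳ-< t₀ _ _ (begin-strict
      toℕ p′ + s + t₀          ≡⟨ +-right-comm (toℕ p′) s t₀ ⟩
      toℕ p′ + t₀ + s          ≡⟨ cong (_+ s) p′+t₀≡p ⟩
      toℕ p + s                <⟨ bound ⟩
      n + (t₀ + j * t₀)        ≡⟨ +-assoc n t₀ (j * t₀) ⟨
      n + t₀ + j * t₀          ≡⟨ +-right-comm n t₀ (j * t₀) ⟩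
      n + j * t₀ + t₀          ∎)
      where open ≤-Reasoning

  retreat : ∀ {t} → T t ≡ true → s₀ + t ≤ n → ∀ j (p : Fin n) → t ≤ toℕ p + j * s₀ →
    ∃₂ λ e ℓ → ℓ ≤ j × Path A (suc ℓ) p e × toℕ e + t ≡ toℕ p + ℓ * s₀
  retreat {t} Tt s₀+t≤n j p bound with t ≤? toℕ p
  ... | yes fits =
    let e , e+t≡p , Ape = step-backward Tt (T-positive Tt) p fits
    in e , 0 , z≤n , Ape ◅ ε , trans e+t≡p (sym (+-identityʳ (toℕ p)))
  retreat {t} Tt s₀+t≤n zero p bound | no ¬fits =
    contradiction (subst (t ≤_) (+-identityʳ (toℕ p)) bound) ¬fits
  retreat {t} Tt s₀+t≤n (suc j) p bound | no ¬fits =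
    let p′ , p′≡p+s₀ , App′ = forward-s₀ p room
        e , ℓ , ℓ≤j , path , e+t≡p′+ℓs₀ =
          retreat Tt s₀+t≤n j p′ (subst (t ≤_) (forward-balance j p′≡p+s₀) bound)
    in e , suc ℓ , s≤s ℓ≤j , App′ ◅ path , trans e+t≡p′+ℓs₀ (sym (forward-balance ℓ p′≡p+s₀))
    where
    room : toℕ p + s₀ < n
    room = <-≤-trans (+-monoˡ-< s₀ (≰⇒> ¬fits)) (≤-trans (≤-reflexive (+-comm t s₀)) s₀+t≤n)

  realign : ∀ e {ℓ k} → ℓ ≤ k → e + (k ∸ ℓ) * s₀ ≡ e + ℓ * t₀ + k * s₀ ⟨mod Q ⟩
  realign e {ℓ} {k} ℓ≤k = begin
    e + (k ∸ ℓ) * s₀                    ≈⟨ a+k*m≡a (e + (k ∸ ℓ) * s₀) ℓ ⟨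
    e + (k ∸ ℓ) * s₀ + ℓ * (s₀ + t₀)    ≡⟨ regroup e (k ∸ ℓ) ℓ s₀ t₀ ⟩
    e + ℓ * t₀ + (k ∸ ℓ + ℓ) * s₀       ≡⟨ cong (λ m → e + ℓ * t₀ + m * s₀) (m∸n+n≡m ℓ≤k) ⟩
    e + ℓ * t₀ + k * s₀                 ∎
    where
    open ≡-mod-Reasoning
    regroup : ∀ e i ℓ s t → e + i * s + ℓ * (s + t) ≡ e + ℓ * t + (i + ℓ) * s
    regroup = solve-∀

  realign-phases : ∀ {a b ℓ ℓ′ k} → a + ℓ * t₀ ≡ b + ℓ′ * t₀ ⟨mod Q ⟩ → ℓ ≤ k → ℓ′ ≤ k →
    a + (k ∸ ℓ) * s₀ ≡ b + (k ∸ ℓ′) * s₀ ⟨mod Q ⟩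
  realign-phases {a} {b} {ℓ} {ℓ′} {k} in-phase ℓ≤k ℓ′≤k = begin
    a + (k ∸ ℓ) * s₀          ≈⟨ realign a ℓ≤k ⟩
    a + ℓ * t₀ + k * s₀       ≈⟨ +-congʳ (k * s₀) in-phase ⟩
    b + ℓ′ * t₀ + k * s₀      ≈⟨ realign b ℓ′≤k ⟨
    b + (k ∸ ℓ′) * s₀         ∎
    where open ≡-mod-Reasoning

  converge : Q ≤ n → ∀ {k u v eᵤ eᵥ ℓᵤ ℓᵥ} → Path A ℓᵤ u eᵤ → Path A ℓᵥ v eᵥ →
    toℕ eᵤ + ℓᵤ * t₀ ≡ toℕ eᵥ + ℓᵥ * t₀ ⟨mod Q ⟩ →
    ℓᵤ ≤ k → ℓᵥ ≤ k → n ≤ (k ∸ ℓᵤ) * t₀ → n ≤ (k ∸ ℓᵥ) * t₀ → CommonTarget A k u v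
  converge Q≤n {k} {u} {v} {eᵤ} {eᵥ} {ℓᵤ} {ℓᵥ} pᵤ pᵥ in-phase ℓᵤ≤k ℓᵥ≤k roomᵤ roomᵥ
    with yᵤ , yᵤ≡ , qᵤ ← walkToResidue Q≤n (k ∸ ℓᵤ) eᵤ roomᵤ
       | yᵥ , yᵥ≡ , qᵥ ← walkToResidue Q≤n (k ∸ ℓᵥ) eᵥ roomᵥ
    with refl ← toℕ-injective {i = yᵤ} {j = yᵥ}
                  (trans yᵤ≡ (trans (realign-phases in-phase ℓᵤ≤k ℓᵥ≤k) (sym yᵥ≡)))
    = yᵤ , subst (λ m → Path A m u yᵤ) (m+[n∸m]≡n ℓᵤ≤k) (pᵤ ◅◅ qᵤ)
         , subst (λ m → Path A m v yᵤ) (m+[n∸m]≡n ℓᵥ≤k) (pᵥ ◅◅ qᵥ)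

  rebalance : ∀ {p q x x′ v z α β e e′ ℓ ℓ′} → p + α + v ≡ q + β + x ⟨mod Q ⟩ →
    e + ℓ * t₀ + x ≡ p + z ⟨mod Q ⟩ → e′ + ℓ′ * t₀ + x′ ≡ q + z ⟨mod Q ⟩ →
    e + (α + suc ℓ * t₀) + v ≡ e′ + (β + suc ℓ′ * t₀) + x′ ⟨mod Q ⟩
  rebalance {p} {q} {x} {x′} {v} {z} {α} {β} {e} {e′} {ℓ} {ℓ′} balanced e≡p+z e′≡q+z = +-cancelʳ x (begin
    e + (α + suc ℓ * t₀) + v + x        ≡⟨ regroupᵖ e ℓ t₀ x α v ⟩
    (e + ℓ * t₀ + x) + (α + t₀ + v)     ≈⟨ +-congʳ (α + t₀ + v) e≡p+z ⟩
    (p + z) + (α + t₀ + v)              ≡⟨ swap p z α t₀ v ⟩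
    (p + α + v) + (z + t₀)              ≈⟨ +-congʳ (z + t₀) balanced ⟩
    (q + β + x) + (z + t₀)              ≡⟨ swap q z β t₀ x ⟨
    (q + z) + (β + t₀ + x)              ≈⟨ +-congʳ (β + t₀ + x) e′≡q+z ⟨
    (e′ + ℓ′ * t₀ + x′) + (β + t₀ + x)  ≡⟨ regroupᵠ e′ ℓ′ t₀ x′ β x ⟨
    e′ + (β + suc ℓ′ * t₀) + x′ + x     ∎)
    where
    open ≡-mod-Reasoning
    regroupᵖ : ∀ e ℓ t x α v → e + (α + (t + ℓ * t)) + v + x ≡ (e + ℓ * t + x) + (α + t + v)
    regroupᵖ = solve-∀
    regroupᵠ : ∀ e ℓ t x′ β x → e + (β + (t + ℓ * t)) + x′ + x ≡ (e + ℓ * t + x′) + (β + t + x)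
    regroupᵠ = solve-∀
    swap : ∀ p z α t v → (p + z) + (α + t + v) ≡ (p + α + v) + (z + t)
    swap = solve-∀

  module _ (c : ℕ)
    (S-fits : ∀ {s} → S s ≡ true → s + t₀ ≤ n) (T-fits : ∀ {t} → T t ≡ true → s₀ + t ≤ n)
    (S-bounded : ∀ {s} → S s ≡ true → s ≤ c * t₀) (T-bounded : ∀ {t} → T t ≡ true → t ≤ c * s₀) where

    follow : ∀ {x z} → A x z ≡ true → (p : Fin n) →
      ∃₂ λ e ℓ → ℓ ≤ c × Path A (suc ℓ) p e × toℕ e + ℓ * t₀ + toℕ x ≡ toℕ p + toℕ z ⟨mod Q ⟩
    follow {x} {z} Axz p with arc⁻ Axz
    ... | inj₁ (s , Ss , z≡x+s) =
      let e , ℓ , ℓ≤c , path , e+ℓt₀≡p+s = advance Ss (S-fits Ss) c p (+-mono-<-≤ (toℕ<n p) (S-bounded Ss))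
      in e , ℓ , ℓ≤c , path , cong (_% Q) (forward-phase e+ℓt₀≡p+s)
      where
      forward-phase : ∀ {a} → a ≡ toℕ p + s → a + toℕ x ≡ toℕ p + toℕ z
      forward-phase {a} refl = begin
        toℕ p + s + toℕ x     ≡⟨ +-assoc (toℕ p) s (toℕ x) ⟩
        toℕ p + (s + toℕ x)   ≡⟨ cong (toℕ p +_) (trans (+-comm s (toℕ x)) (sym z≡x+s)) ⟩
        toℕ p + toℕ z         ∎
        where open ≡-Reasoning
    ... | inj₂ (t , Tt , x≡z+t) =
      let e , ℓ , ℓ≤c , path , e+t≡p+ℓs₀ =
            retreat Tt (T-fits Tt) c p (≤-trans (T-bounded Tt) (m≤n+m _ (toℕ p)))
      in e , ℓ , ℓ≤c , path , backward-phase {toℕ e} {ℓ} e+t≡p+ℓs₀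
      where
      backward-phase : ∀ {e ℓ} → e + t ≡ toℕ p + ℓ * s₀ → e + ℓ * t₀ + toℕ x ≡ toℕ p + toℕ z ⟨mod Q ⟩
      backward-phase {e} {ℓ} e+t≡p+ℓs₀ = begin
        e + ℓ * t₀ + toℕ x                ≡⟨ cong (e + ℓ * t₀ +_) x≡z+t ⟩
        e + ℓ * t₀ + (toℕ z + t)          ≡⟨ regroup e ℓ t₀ (toℕ z) t ⟩
        e + t + ℓ * t₀ + toℕ z            ≡⟨ cong (λ m → m + ℓ * t₀ + toℕ z) e+t≡p+ℓs₀ ⟩
        toℕ p + ℓ * s₀ + ℓ * t₀ + toℕ z   ≡⟨ collect (toℕ p) ℓ s₀ t₀ (toℕ z) ⟩
        toℕ p + toℕ z + ℓ * Q             ≈⟨ a+k*m≡a (toℕ p + toℕ z) ℓ ⟩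
        toℕ p + toℕ z                     ∎
        where
        open ≡-mod-Reasoning
        regroup : ∀ e ℓ t₀ z t → e + ℓ * t₀ + (z + t) ≡ e + t + ℓ * t₀ + z
        regroup = solve-∀
        collect : ∀ p ℓ s₀ t₀ z → p + ℓ * s₀ + ℓ * t₀ + z ≡ p + z + ℓ * (s₀ + t₀)
        collect = solve-∀

    record Rendezvous (p q : Fin n) (α β bound : ℕ) : Set where
      field
        {endᵖ endᵠ} : Fin n
        {lenᵖ lenᵠ} : ℕ
        pathᵖ : Path A lenᵖ p endᵖ
        pathᵠ : Path A lenᵠ q endᵠ
        lenᵖ≤ : lenᵖ ≤ bound
        lenᵠ≤ : lenᵠ ≤ bound
        in-phase : toℕ endᵖ + lenᵖ * t₀ + α ≡ toℕ endᵠ + lenᵠ * t₀ + β ⟨mod Q ⟩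

    -- Walkers from p and q imitate the arcs x → z ← x′ of each step of w (an arc of
    -- the digraph of A Aᵀ); the hypothesis says that their phases, offset by α and β,
    -- differ by x − v.
    rendezvous : ∀ {P x v} (w : Walk (A ⊗ (A ᵀ)) P x v) (p q : Fin n) (α β : ℕ) →
      toℕ p + α + toℕ v ≡ toℕ q + β + toℕ x ⟨mod Q ⟩ → Rendezvous p q α β (walkLength w * suc c)
    rendezvous {v = v} here p q α β balanced = record
      { pathᵖ = ε ; pathᵠ = ε ; lenᵖ≤ = z≤n ; lenᵠ≤ = z≤n
      ; in-phase = begin
          toℕ p + 0 + α     ≡⟨ cong (_+ α) (+-identityʳ (toℕ p)) ⟩
          toℕ p + α         ≈⟨ +-cancelʳ (toℕ v) balanced ⟩
          toℕ q + β         ≡⟨ cong (_+ β) (+-identityʳ (toℕ q)) ⟨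
          toℕ q + 0 + β     ∎
      }
      where open ≡-mod-Reasoning
    rendezvous {x = x} {v} (step {w = x′} AAᵀxx′ _ w) p q α β balanced =
      let z , Axz , Ax′z = ⊗-true⁻ A (A ᵀ) AAᵀxx′
          e , ℓ , ℓ≤c , path , e≡p+z = follow Axz p
          e′ , ℓ′ , ℓ′≤c , path′ , e′≡q+z = follow Ax′z q
          rest = rendezvous w e e′ (α + suc ℓ * t₀) (β + suc ℓ′ * t₀)
                   (rebalance {z = toℕ z} {e = toℕ e} {toℕ e′} {ℓ} {ℓ′} balanced e≡p+z e′≡q+z)
          open Rendezvous rest
      in record
        { pathᵖ = path ◅◅ pathᵖ ; pathᵠ = path′ ◅◅ pathᵠ
        ; lenᵖ≤ = +-mono-≤ (s≤s ℓ≤c) lenᵖ≤ ; lenᵠ≤ = +-mono-≤ (s≤s ℓ′≤c) lenᵠ≤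
        ; in-phase = begin
            toℕ endᵖ + (suc ℓ + lenᵖ) * t₀ + α   ≡⟨ shift (toℕ endᵖ) (suc ℓ) lenᵖ t₀ α ⟩
            toℕ endᵖ + lenᵖ * t₀ + (α + suc ℓ * t₀) ≈⟨ in-phase ⟩
            toℕ endᵠ + lenᵠ * t₀ + (β + suc ℓ′ * t₀) ≡⟨ shift (toℕ endᵠ) (suc ℓ′) lenᵠ t₀ β ⟨
            toℕ endᵠ + (suc ℓ′ + lenᵠ) * t₀ + β   ∎
        }
      where
      open ≡-mod-Reasoning
      shift : ∀ e ℓ L t α → e + (ℓ + L) * t + α ≡ e + L * t + (α + ℓ * t)
      shift = solve-∀

-- The competition index

module CompetitionIndexBound {n : ℕ} {S T : ℕ → Bool}
  (S⊆ : ∀ x → S x ≡ true → (1 ≤ x) × (x < n)) (T⊆ : ∀ x → T x ≡ true → (1 ≤ x) × (x < n))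
  {s₁ sₖ t₁ tₖ : ℕ} (s₁-min : IsMin S s₁) (sₖ-max : IsMax S sₖ) (t₁-min : IsMin T t₁) (tₖ-max : IsMax T tₖ)
  (sₖ+t₁≤n : sₖ + t₁ ≤ n) (s₁+tₖ≤n : s₁ + tₖ ≤ n) where

  d c N X K : ℕ
  d = sumGcd n S T
  c = ⌈ tₖ / s₁ ⌉ ⊔ ⌈ sₖ / t₁ ⌉
  N = ⌈ n / d ⌉
  X = (N ∸ 1) * (c + 1)
  K = 2 * (N ∸ 1) * (c + 1) + 2 * (s₁ + t₁)

  s₁∈S : S s₁ ≡ true
  s₁∈S = proj₁ s₁-min
  t₁∈T : T t₁ ≡ true
  t₁∈T = proj₁ t₁-min

  open ToeplitzWalks {n} (λ {s} Ss → proj₁ (S⊆ s Ss)) (λ {t} Tt → proj₁ (T⊆ t Tt)) s₁∈S t₁∈T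

  S-fits : ∀ {s} → S s ≡ true → s + t₁ ≤ n
  S-fits {s} Ss = ≤-trans (+-monoˡ-≤ t₁ (proj₂ sₖ-max s Ss)) sₖ+t₁≤n

  Q≤n : Q ≤ n
  Q≤n = S-fits s₁∈S

  T-fits : ∀ {t} → T t ≡ true → s₁ + t ≤ n
  T-fits {t} Tt = ≤-trans (+-monoʳ-≤ s₁ (proj₂ tₖ-max t Tt)) s₁+tₖ≤n

  S-bounded : ∀ {s} → S s ≡ true → s ≤ c * t₁
  S-bounded {s} Ss = begin
    s                   ≤⟨ proj₂ sₖ-max s Ss ⟩
    sₖ                  ≤⟨ ≤⌈/⌉* sₖ t₁ (proj₁ (T⊆ t₁ t₁∈T)) ⟩
    ⌈ sₖ / t₁ ⌉ * t₁    ≤⟨ *-monoˡ-≤ t₁ (m≤n⊔m ⌈ tₖ / s₁ ⌉ ⌈ sₖ / t₁ ⌉) ⟩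
    c * t₁              ∎
    where open ≤-Reasoning

  T-bounded : ∀ {t} → T t ≡ true → t ≤ c * s₁
  T-bounded {t} Tt = begin
    t                   ≤⟨ proj₂ tₖ-max t Tt ⟩
    tₖ                  ≤⟨ ≤⌈/⌉* tₖ s₁ (proj₁ (S⊆ s₁ s₁∈S)) ⟩
    ⌈ tₖ / s₁ ⌉ * s₁    ≤⟨ *-monoˡ-≤ s₁ (m≤m⊔n ⌈ tₖ / s₁ ⌉ ⌈ sₖ / t₁ ⌉) ⟩
    c * s₁              ∎
    where open ≤-Reasoning

  d∣s+t : ∀ {s t} → S s ≡ true → T t ≡ true → d ∣ s + t
  d∣s+t {s} {t} Ss Tt = sumGcd-∣ Ss (proj₂ (S⊆ s Ss)) Tt (proj₂ (T⊆ t Tt))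

  d≤Q : d ≤ Q
  d≤Q = ∣⇒≤ (d∣s+t s₁∈S t₁∈T)

  instance
    d-nonZero : NonZero d
    d-nonZero = ≢-nonZero λ d≡0 → ≢-nonZero⁻¹ Q (0∣⇒≡0 (subst (_∣ Q) d≡0 (d∣s+t s₁∈S t₁∈T)))

  open ToeplitzResidues {n} d (λ {s} {t} → d∣s+t {s} {t}) s₁∈S t₁∈T using (CommonTarget⇒≡)

  open ModularArithmetic d using (+-cancelʳ; +-congʳ; a%m≡a; [mod]⇔≡)

  Class : ℕ → Fin n → Set
  Class i v = (toℕ v + 1) ≡ i [mod d ]

  Class-quotient-injective : ∀ {i x y} → Class i x → Class i y → toℕ x / d ≡ toℕ y / d → x ≡ y
  Class-quotient-injective {i} {x} {y} x∈i y∈i x/d≡y/d = toℕ-injective (begin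
    toℕ x                       ≡⟨ m≡m%n+[m/n]*n (toℕ x) d ⟩
    toℕ x % d + toℕ x / d * d   ≡⟨ cong₂ (λ r q → r + q * d) x≡y x/d≡y/d ⟩
    toℕ y % d + toℕ y / d * d   ≡⟨ m≡m%n+[m/n]*n (toℕ y) d ⟨
    toℕ y                       ∎)
    where
    open ≡-Reasoning
    x≡y : toℕ x ≡ toℕ y ⟨mod d ⟩
    x≡y = +-cancelʳ 1 (trans (to ([mod]⇔≡ _ i) x∈i) (sym (to ([mod]⇔≡ _ i) y∈i)))

  Class-of : ∀ {u v} → toℕ u ≡ toℕ v ⟨mod d ⟩ → Class (toℕ u % d + 1) u × Class (toℕ u % d + 1) v
  Class-of {u} {v} u≡v =
    from ([mod]⇔≡ _ _) (+-congʳ 1 (sym (a%m≡a (toℕ u)))) ,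
    from ([mod]⇔≡ _ _) (+-congʳ 1 (trans (sym u≡v) (sym (a%m≡a (toℕ u)))))

  Q≤[c+1]t₁ : Q ≤ (c + 1) * t₁
  Q≤[c+1]t₁ = begin
    s₁ + t₁          ≤⟨ +-monoˡ-≤ t₁ (S-bounded s₁∈S) ⟩
    c * t₁ + t₁      ≡⟨ cong (c * t₁ +_) (*-identityˡ t₁) ⟨
    c * t₁ + 1 * t₁  ≡⟨ *-distribʳ-+ t₁ c 1 ⟨
    (c + 1) * t₁     ∎
    where open ≤-Reasoning

  enough-room : ∀ {L} → X + Q ≤ L → n ≤ L * t₁
  enough-room {L} X+Q≤L = begin
    n                                     ≤⟨ ≤⌈/⌉* n d (>-nonZero⁻¹ d) ⟩
    N * d                                 ≤⟨ *-monoˡ-≤ d (m≤n+m∸n N 1) ⟩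
    d + (N ∸ 1) * d                       ≤⟨ +-mono-≤ (≤-trans d≤Q (m≤m*n Q t₁ {{>-nonZero t₁≥1}}))
                                                      (*-monoʳ-≤ (N ∸ 1) (≤-trans d≤Q Q≤[c+1]t₁)) ⟩
    Q * t₁ + (N ∸ 1) * ((c + 1) * t₁)     ≡⟨ regroup Q (N ∸ 1) (c + 1) t₁ ⟩
    (X + Q) * t₁                          ≤⟨ *-monoˡ-≤ t₁ X+Q≤L ⟩
    L * t₁                                ∎
    where
    open ≤-Reasoning
    t₁≥1 : 1 ≤ t₁
    t₁≥1 = proj₁ (T⊆ t₁ t₁∈T)
    regroup : ∀ q a b t → q * t + a * (b * t) ≡ (a * b + q) * t
    regroup = solve-∀

  X+Q+X≤K : X + Q + X ≤ K
  X+Q+X≤K = ≤-trans (m≤m+n (X + Q + X) Q) (≤-reflexive (regroup (N ∸ 1) (c + 1) Q))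
    where
    regroup : ∀ a b q → a * b + q + a * b + q ≡ 2 * a * b + 2 * q
    regroup = solve-∀

  room : ∀ {ℓ k} → ℓ ≤ X → K ≤ k → ℓ ≤ k × n ≤ (k ∸ ℓ) * t₁
  room {ℓ} {k} ℓ≤X K≤k =
    ≤-trans (m≤n+m ℓ (X + Q)) X+Q+ℓ≤k , enough-room (m+n≤o⇒m≤o∸n (X + Q) X+Q+ℓ≤k)
    where
    X+Q+ℓ≤k : X + Q + ℓ ≤ k
    X+Q+ℓ≤k = ≤-trans (+-monoʳ-≤ (X + Q) ℓ≤X) (≤-trans X+Q+X≤K K≤k)

  IrreducibleClasses : Set
  IrreducibleClasses = ∀ i → 1 ≤ i → i ≤ d → IrreducibleOn (A ⊗ (A ᵀ)) (Class i)

  ≡⇒CommonTarget : IrreducibleClasses → ∀ {k u v} → K ≤ k →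
    toℕ u ≡ toℕ v ⟨mod d ⟩ → CommonTarget A k u v
  ≡⇒CommonTarget irreducible {k} {u} {v} K≤k u≡v =
    converge Q≤n pathᵖ pathᵠ in-phase′ (proj₁ roomᵖ) (proj₁ roomᵠ) (proj₂ roomᵖ) (proj₂ roomᵠ)
    where
    i : ℕ
    i = toℕ u % d + 1
    u∈i : Class i u
    u∈i = proj₁ (Class-of u≡v)
    v∈i : Class i v
    v∈i = proj₂ (Class-of u≡v)
    i≤d : i ≤ d
    i≤d = subst (_≤ d) (+-comm 1 (toℕ u % d)) (m%n<n (toℕ u) d)
    short : Σ (Walk (A ⊗ (A ᵀ)) (Class i) u v) λ w → walkLength w < N
    short = shortWalk (λ x → toℕ x / d) (λ {x} _ → /<⌈/⌉ d (toℕ<n x)) Class-quotient-injective u∈i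
              (irreducible i (m≤n+m 1 (toℕ u % d)) i≤d u v u∈i v∈i)
    balanced : toℕ u + 0 + toℕ v ≡ toℕ v + 0 + toℕ u ⟨mod Q ⟩
    balanced = cong (_% Q) (swap (toℕ u) (toℕ v))
      where
      swap : ∀ a b → a + 0 + b ≡ b + 0 + a
      swap = solve-∀
    open Rendezvous (rendezvous c S-fits T-fits S-bounded T-bounded (proj₁ short) u v 0 0 balanced)
    in-phase′ : toℕ endᵖ + lenᵖ * t₁ ≡ toℕ endᵠ + lenᵠ * t₁ ⟨mod Q ⟩
    in-phase′ = subst₂ (λ a b → a % Q ≡ b % Q) (+-identityʳ _) (+-identityʳ _) in-phase
    length≤X : walkLength (proj₁ short) * suc c ≤ X
    length≤X = ≤-trans (*-monoˡ-≤ (suc c) (∸-monoˡ-≤ 1 (proj₂ short)))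
                       (≤-reflexive (cong ((N ∸ 1) *_) (+-comm 1 c)))
    roomᵖ : lenᵖ ≤ k × n ≤ (k ∸ lenᵖ) * t₁
    roomᵖ = room (≤-trans lenᵖ≤ length≤X) K≤k
    roomᵠ : lenᵠ ≤ k × n ≤ (k ∸ lenᵠ) * t₁
    roomᵠ = room (≤-trans lenᵠ≤ length≤X) K≤k

  competition⇔≡ : IrreducibleClasses → ∀ {k u v} → K ≤ k →
    ((A ^ k) ⊗ ((A ᵀ) ^ k)) u v ≡ true ⇔ (toℕ u ≡ toℕ v ⟨mod d ⟩)
  competition⇔≡ irreducible {k} K≤k = mk⇔
    (CommonTarget⇒≡ ∘ to (competition⇔CommonTarget A k))
    (from (competition⇔CommonTarget A k) ∘ ≡⇒CommonTarget irreducible K≤k)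

  competitionProperty : IrreducibleClasses → CompetitionProperty A K
  competitionProperty irreducible = 1 , ≤-refl , λ i u v →
    let now = competition⇔≡ irreducible {u = u} {v} (m≤m+n K i)
        later = competition⇔≡ irreducible {u = u} {v} (≤-trans (m≤m+n K 1) (m≤m+n (K + 1) i))
    in ⇔→≡ (mk⇔ (from later ∘ to now) (from now ∘ to later))

  1≤K : 1 ≤ K
  1≤K = begin
    1                ≤⟨ proj₁ (S⊆ s₁ s₁∈S) ⟩
    s₁               ≤⟨ m≤m+n s₁ t₁ ⟩
    Q                ≤⟨ m≤m+n Q (Q + 0) ⟩
    2 * Q            ≤⟨ m≤n+m (2 * Q) (2 * (N ∸ 1) * (c + 1)) ⟩
    K                ∎
    where open ≤-Reasoning

theorem3p5 :
  (n : ℕ) → 2 ≤ n →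
  (S T : ℕ → Bool) →
  (∀ x → S x ≡ true → (1 ≤ x) × (x < n)) →
  (∀ x → T x ≡ true → (1 ≤ x) × (x < n)) →
  (s₁ sₖ t₁ tₖ : ℕ) →
  IsMin S s₁ → IsMax S sₖ → IsMin T t₁ → IsMax T tₖ →
  sₖ + t₁ ≤ n → s₁ + tₖ ≤ n →
  let A = Toeplitz n S T
      d = sumGcd n S T
  in (∀ i → 1 ≤ i → i ≤ d →
        IrreducibleOn (A ⊗ (A ᵀ)) (λ (v : Fin n) → (toℕ v + 1) ≡ i [mod d ])) →
     ∀ q → IsCompetitionIndex A q →
     q ≤ 2 * (⌈ n / d ⌉ ∸ 1) * ((⌈ tₖ / s₁ ⌉ ⊔ ⌈ sₖ / t₁ ⌉) + 1) + 2 * (s₁ + t₁)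
theorem3p5 n _ S T S⊆ T⊆ s₁ sₖ t₁ tₖ s₁-min sₖ-max t₁-min tₖ-max sₖ+t₁≤n s₁+tₖ≤n irreducible
           q (_ , _ , minimal) =
  minimal K 1≤K (competitionProperty irreducible)
  where open CompetitionIndexBound S⊆ T⊆ s₁-min sₖ-max t₁-min tₖ-max sₖ+t₁≤n s₁+tₖ≤n
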